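{- Let $\mathbb{S}$ be a step space, $V\colon\mathbb{S}\to\mathbb{S}$ an iterative operator, and $\mathcal{C}$ an acyclic cone (with respect to $V$) with crux $s_{\mathrm{crux}}$. Then the map sending each localized predecessor walk $w\in\mathcal{C}$ to its edge step is a one-to-one correspondence between $\mathcal{C}$ and $\operatorname{edge}\mathcal{C}$.
   Context: A step space is a set $\mathbb{S}=\Lambda\times\mathscr{F}\times\mathbf{F}$ whose elements (steps) are triples whose first coordinate, the locus $\mho_\Lambda(s)$, lies in a finite non-empty set $\Lambda$ of loci. An iterative operator is any mapping $V\colon\mathbb{S}\to\mathbb{S}$; its converse is $\tilde V(s)=\{t\in\mathbb{S}: V(t)=s\}$, and $t$ precedes $s$ if $t\in\tilde V(s)$. Fix a crux step $s_{\mathrm{crux}}\in\mathbb{S}$. A localized predecessor walk is a finite sequence $w=(w_0,w_{ -1},\dots,w_{ -(n-1)})$ of steps, $n=|w|\ge1$, indexed by $0,-1,\dots,-(n-1)$, with $w_0=s_{\mathrm{crux}}$ and $w_{i-1}\in\tilde V(w_i)$ for each $-(n-2)\le i\le 0$. A set $\mathbb{W}$ of such walks is complete if for every $w\in\mathbb{W}$, every $i$ with $-(|w|-2)\le i\le0$, and every $s\in\tilde V(w_i)$ there is $e\in\mathbb{W}$ with $e_i=w_i$ and $e_{i-1}=s$. Two distinct walks $w,w'$ with $|w'|\le|w|$ and $w'_i=w_i$ for all $-(|w'|-1)\le i\le0$ are dependent, with $w'$ dispensable; $\mathbb{W}$ is independent if it contains no dispensable member (relative to another member). A cone $\mathcal{C}$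 is a complete independent set of localized predecessor walks starting at $s_{\mathrm{crux}}$. The edge step of $w$ is its last term $w_{ -(|w|-1)}$, and $\operatorname{edge}\mathcal{C}$ is the set of edge steps of members of $\mathcal{C}$. The cone is acyclic if the path projection of its walks has no cycle (loop), i.e. for every $w\in\mathcal{C}$ the loci $\mho_\Lambda(w_0),\mho_\Lambda(w_{ -1}),\dots,\mho_\Lambda(w_{ -(|w|-1)})$ are pairwise distinct. -}

module Defs where

open import Data.Nat using (ℕ; zero; suc; _<_; _≤_)
open import Data.Fin using (Fin)
open import Data.Product using (Σ; ∃; _×_; _,_; proj₁)
open import Data.Maybe using (Maybe; just; nothing)
open import Data.List using (List; []; _∷_; length; map)
open import Data.List.NonEmpty using (List⁺; toList; head; last)
open import Data.List.Relation.Unary.Linked using (Linked)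
open import Data.List.Relation.Unary.Unique.Propositional using (Unique)
open import Relation.Binary.PropositionalEquality using (_≡_; _≢_)
open import Relation.Nullary using (¬_)
open import Function.Bundles using (_↔_)

-- A step space 𝕊 = Λ × 𝓕 × 𝐅, with Λ finite and non-empty
-- (finiteness/non-emptiness is an explicit hypothesis  Λ ↔ Fin (suc k)  in the theorem).
Step : Set → Set → Set → Set
Step Λ F₁ F₂ = Λ × F₁ × F₂

locus : {Λ F₁ F₂ : Set} → Step Λ F₁ F₂ → Λ
locus = proj₁

-- safe lookup: w at position j represents the term w_{-j}
at : {A : Set} → List A → ℕ → Maybe A
at []       _       = nothing
at (x ∷ xs) zero    = just x
at (x ∷ xs) (suc j) = at xs j

module _ {S : Set} (V : S → S) (crux : S) where

  -- t precedes s  iff  t ∈ Ṽ(s)  iff  V t ≡ s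
  Precedes : S → S → Set
  Precedes t s = V t ≡ s

  -- A walk (w₀, w₋₁, …, w₋₍ₙ₋₁₎) is stored as the non-empty list w₀ ∷ w₋₁ ∷ … .
  -- Localized predecessor walk: w₀ = crux and w_{i-1} ∈ Ṽ(w_i).
  IsLPWalk : List⁺ S → Set
  IsLPWalk w = (head w ≡ crux) × Linked (λ a b → Precedes b a) (toList w)

  len : List⁺ S → ℕ
  len w = length (toList w)

  -- Complete set of walks (a set of walks is a predicate on List⁺ S):
  -- for w ∈ W, -(|w|-2) ≤ i ≤ 0 (i = -j), and s ∈ Ṽ(w_i), some e ∈ W has
  -- e_i = w_i and e_{i-1} = s.
  Complete : (List⁺ S → Set) → Set
  Complete W = ∀ w → W w → ∀ j → suc j < len w → ∀ s → ∀ a → at (toList w) j ≡ just a →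
    Precedes s a →
    Σ (List⁺ S) λ e → W e × at (toList e) j ≡ just a × at (toList e) (suc j) ≡ just s

  Dispensable : List⁺ S → List⁺ S → Set
  Dispensable w' w = (w ≢ w') × (len w' ≤ len w) ×
    (∀ j → j < len w' → at (toList w') j ≡ at (toList w) j)

  Independent : (List⁺ S → Set) → Set
  Independent W = ∀ w w' → W w → W w' → ¬ Dispensable w' w

  IsCone : (List⁺ S → Set) → Set
  IsCone C = (∀ w → C w → IsLPWalk w) × Complete C × Independent C


Acyclic : {Λ F₁ F₂ : Set} → (List⁺ (Step Λ F₁ F₂) → Set) → Set
Acyclic C = ∀ w → C w → Unique (map locus (toList w))

edge : {S : Set} → List⁺ S → S
edge = last

InEdge : {S : Set} → (List⁺ S → Set) → S → Set
InEdge {S} C s = Σ (List⁺ S) λ w → C w × edge w ≡ s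

-- An acyclic predecessor walk ending at e is the backward V-orbit
-- (Vⁿ e, …, V e, e) for n = |w| - 1, so it is determined by its edge step e and its
-- length.  Two walks of a cone with the same edge step both start at the crux; if
-- their lengths differed, the crux would occur twice in the longer orbit, contradicting
-- that its loci are pairwise distinct.
module Submission where

open import Defs
open import Data.Nat using (ℕ; zero; suc; _≤_; _<_; z≤n; s≤s)
open import Data.Nat.Properties using (<-cmp; m≤n⇒m<n∨m≡n)
open import Data.Fin using (Fin)
open import Data.Product using (Σ; _×_; _,_)
open import Data.Sum using (inj₁; inj₂)
open import Data.List using (List; []; _∷_; length)
import Data.List as List
open import Data.List.NonEmpty using (List⁺; _∷_; _∷⁺_; toList; head; tail; last)
open import Data.List.Relation.Unary.Linked using (Linked; _∷_)
open import Data.List.Relation.Unary.All using (lookup)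
open import Data.List.Relation.Unary.Any using (here; there)
open import Data.List.Relation.Unary.AllPairs using (_∷_)
open import Data.List.Relation.Unary.Unique.Propositional using (Unique)
open import Data.List.Relation.Unary.Unique.Propositional.Properties using (map⁻)
open import Data.List.Membership.Propositional using (_∈_)
open import Data.Empty using (⊥-elim)
open import Relation.Binary.Definitions using (tri<; tri≈; tri>)
open import Relation.Binary.PropositionalEquality using (_≡_; _≢_; refl; sym; cong; subst; module ≡-Reasoning)
open import Relation.Nullary using (¬_)
open import Function.Bundles using (_↔_)

last-∷⁺ : {A : Set} (x : A) (w : List⁺ A) → last (x ∷⁺ w) ≡ last w
last-∷⁺ x (y ∷ ys) with List.initLast ys
... | []               = refl
... | zs List.∷ʳ′ z    = refl

¬Unique-∷-∈ : {A : Set} {x : A} {xs : List A} → x ∈ xs → ¬ Unique (x ∷ xs)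
¬Unique-∷-∈ x∈xs (x∉xs ∷ _) = lookup x∉xs x∈xs refl

module _ {S : Set} (V : S → S) where

  backwardOrbit : ℕ → S → List⁺ S
  backwardOrbit zero    e = e ∷ []
  backwardOrbit (suc n) e = V (head (backwardOrbit n e)) ∷⁺ backwardOrbit n e

  head-backwardOrbit-∈ : ∀ {p q} e → p ≤ q →
    head (backwardOrbit p e) ∈ toList (backwardOrbit q e)
  head-backwardOrbit-∈ {q = zero}  e z≤n = here refl
  head-backwardOrbit-∈ {q = suc q} e p≤q with m≤n⇒m<n∨m≡n p≤q
  ... | inj₁ (s≤s p≤q′) = there (head-backwardOrbit-∈ e p≤q′)
  ... | inj₂ refl       = here refl

  head-backwardOrbit-≢ : ∀ {p q} e → p < q → Unique (toList (backwardOrbit q e)) →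
    head (backwardOrbit p e) ≢ head (backwardOrbit q e)
  head-backwardOrbit-≢ {q = suc q} e (s≤s p≤q) orbit! hp≡hq =
    ¬Unique-∷-∈ (subst (_∈ _) hp≡hq (head-backwardOrbit-∈ e p≤q)) orbit!

  linked-backwardOrbit : (w : List⁺ S) → Linked (λ a b → V b ≡ a) (toList w) →
    w ≡ backwardOrbit (length (tail w)) (last w)
  linked-backwardOrbit (x ∷ [])     _                    = refl
  linked-backwardOrbit (x ∷ y ∷ ys) (Vy≡x ∷ y∷ys-linked) = begin
    x ∷⁺ (y ∷ ys)                         ≡⟨ cong (_∷⁺ (y ∷ ys)) (sym Vy≡x) ⟩
    V y ∷⁺ (y ∷ ys)                       ≡⟨ cong (λ o → V (head o) ∷⁺ o) (linked-backwardOrbit (y ∷ ys) y∷ys-linked) ⟩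
    backwardOrbit (suc n) (last (y ∷ ys)) ≡⟨ cong (backwardOrbit (suc n)) (sym (last-∷⁺ x (y ∷ ys))) ⟩
    backwardOrbit (suc n) (last (x ∷ y ∷ ys)) ∎
    where
    open ≡-Reasoning
    n : ℕ
    n = length ys

  backwardOrbit-length-unique : ∀ {p q} e →
    Unique (toList (backwardOrbit p e)) → Unique (toList (backwardOrbit q e)) →
    head (backwardOrbit p e) ≡ head (backwardOrbit q e) → p ≡ q
  backwardOrbit-length-unique {p} {q} e p-orbit! q-orbit! heads≡ with <-cmp p q
  ... | tri< p<q _ _ = ⊥-elim (head-backwardOrbit-≢ e p<q q-orbit! heads≡)
  ... | tri≈ _ p≡q _ = p≡q
  ... | tri> _ _ q<p = ⊥-elim (head-backwardOrbit-≢ e q<p p-orbit! (sym heads≡))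

lpWalk-injective-on-edge : {S : Set} (V : S → S) (crux : S) {w w′ : List⁺ S} →
  IsLPWalk V crux w → IsLPWalk V crux w′ → Unique (toList w) → Unique (toList w′) →
  edge w ≡ edge w′ → w ≡ w′
lpWalk-injective-on-edge {S} V crux {w} {w′} (w₀≡crux , w-linked) (w′₀≡crux , w′-linked) w! w′! edges≡ =
  begin
    w                                      ≡⟨ w≡orbit ⟩
    backwardOrbit V (length (tail w)) e    ≡⟨ cong (λ n → backwardOrbit V n e) lengths≡ ⟩
    backwardOrbit V (length (tail w′)) e   ≡⟨ sym w′≡orbit ⟩
    w′                                     ∎
  where
  open ≡-Reasoning
  e : S
  e = last w
  w≡orbit : w ≡ backwardOrbit V (length (tail w)) e
  w≡orbit = linked-backwardOrbit V w w-linked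
  w′≡orbit : w′ ≡ backwardOrbit V (length (tail w′)) e
  w′≡orbit = subst (λ e′ → w′ ≡ backwardOrbit V _ e′) (sym edges≡) (linked-backwardOrbit V w′ w′-linked)
  heads≡ : head (backwardOrbit V (length (tail w)) e) ≡ head (backwardOrbit V (length (tail w′)) e)
  heads≡ = begin
    head (backwardOrbit V (length (tail w)) e)    ≡⟨ cong head (sym w≡orbit) ⟩
    head w                                        ≡⟨ w₀≡crux ⟩
    crux                                          ≡⟨ sym w′₀≡crux ⟩
    head w′                                       ≡⟨ cong head w′≡orbit ⟩
    head (backwardOrbit V (length (tail w′)) e)   ∎
  lengths≡ : length (tail w) ≡ length (tail w′)
  lengths≡ = backwardOrbit-length-unique V e
    (subst (λ o → Unique (toList o)) w≡orbit w!)
    (subst (λ o → Unique (toList o)) w′≡orbit w′!)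
    heads≡
theorem2p6p11 : (Λ F₁ F₂ : Set) (k : ℕ) → (Λ ↔ Fin (suc k)) →
    (V : Step Λ F₁ F₂ → Step Λ F₁ F₂) (crux : Step Λ F₁ F₂) →
    (C : List⁺ (Step Λ F₁ F₂) → Set) → IsCone V crux C → Acyclic C →
    ((w w' : List⁺ (Step Λ F₁ F₂)) → C w → C w' → edge w ≡ edge w' → w ≡ w')
    × ((s : Step Λ F₁ F₂) → InEdge C s → Σ (List⁺ (Step Λ F₁ F₂)) λ w → C w × edge w ≡ s)
theorem2p6p11 Λ F₁ F₂ k _ V crux C (lpWalks , _ , _) acyclic =
  (λ w w′ w∈C w′∈C →
    lpWalk-injective-on-edge V crux (lpWalks w w∈C) (lpWalks w′ w′∈C)
      (map⁻ (acyclic w w∈C)) (map⁻ (acyclic w′ w′∈C)))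
  , λ _ s∈edge𝒞 → s∈edge𝒞
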